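{- Each non-mixed diagram equals $D(w)$ for exactly one word $w$ in the alphabet $\{C,R,S,T\}$ such that $S$ occurs exactly at the positions that create a corner in the lower path, $T$ occurs exactly at the positions that create a corner in the upper path, and $RC$ does not occur as a subword (two consecutive letters). In particular, this word has neither $SS$ nor $TT$ as a subword.
   Context: A diagram is the set of unit squares between two lattice paths $P$ (lower) and $Q$ (upper) from $(0,0)$ to some $(m,r)$ made of unit north ($N$) and east ($E$) steps, with $P$ strictly below $Q$ except at the endpoints. Writing $P=p_1\cdots p_n$, $Q=q_1\cdots q_n$: for each $a$ with $q_a=E$, $q_{a+1}=N$, let $(a_1,a_2)$ be the point where these steps meet (a corner of the upper path); for each $b$ with $p_{b-1}=N$, $p_b=E$, let $(b_1,b_2)$ be the point where these steps meet (a corner of the lower path). The diagram is non-mixed if there is no such pair of corners with $a_1<b_1$ and $a_2>b_2$. For a word $w=w_1\cdots w_k$ in $\{C,R,S,T\}$, $D(w)$ is obtained by starting from a single unit square with lower-left corner $(0,0)$ and applying $w_1,\ldots,w_k$ in order: $R$ adds a new row on top occupying the same columns as the topmost row; $C$ adds a new column on the right occupying the same rows as the rightmost column; $S$ adds one square immediately to the right of the topmost row; $T$ adds one square immediately above the rightmost column. A letter $w_j$ creates a corner if the diagram $D(w)$ has a corner at a point $(c_1,c_2)$ with $c_1+c_2=j$ in the corresponding path. -}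

module Defs where

open import Data.Nat using (ℕ; zero; suc; _+_; _∸_; _≤_; _<_)
open import Data.List using (List; []; _∷_; _++_; length; reverse)
open import Data.Product using (Σ; _×_; _,_; proj₁; proj₂)
open import Relation.Binary.PropositionalEquality using (_≡_)
open import Relation.Nullary using (¬_)
open import Function.Bundles using (_⇔_)

data Step : Set where
  N E : Step

Path : Set
Path = List Step

-- number of east steps among the first i steps, i.e. the x-coordinate of
-- the lattice point reached after i steps (for i ≤ length p);
-- its y-coordinate is i ∸ eastsIn i p.
eastsIn : ℕ → Path → ℕ
eastsIn zero    _       = 0
eastsIn (suc i) []      = 0
eastsIn (suc i) (E ∷ p) = suc (eastsIn i p)
eastsIn (suc i) (N ∷ p) = eastsIn i p

xAt yAt : Path → ℕ → ℕ
xAt p i = eastsIn i p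
yAt p i = i ∸ eastsIn i p

-- Diagrams: a diagram is represented by its pair (P , Q) of lower and
-- upper boundary paths (which it determines uniquely).

-- P strictly below Q except at the endpoints, both from (0,0) to the
-- same point (m , r); P ≠ Q (at least one square), i.e. length ≥ 2.
IsDiagram : Path → Path → Set
IsDiagram P Q =
  length P ≡ length Q ×
  2 ≤ length P ×
  eastsIn (length P) P ≡ eastsIn (length Q) Q ×
  (∀ i → 0 < i → i < length P → eastsIn i Q < eastsIn i P)

-- corner of the upper path: q_a = E, q_{a+1} = N (1-indexed); the corner
-- point is the point reached after a steps.
UpperCornerAt : Path → ℕ → Set
UpperCornerAt q a = Σ Path λ u → Σ Path λ v → (q ≡ u ++ E ∷ N ∷ v) × (length u + 1 ≡ a)

-- corner of the lower path: p_{b-1} = N, p_b = E (1-indexed); the corner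
-- point is the point reached after b-1 steps.  We index by c = b - 1,
-- i.e. by the sum of the coordinates of the corner point.
LowerCornerAt : Path → ℕ → Set
LowerCornerAt p c = Σ Path λ u → Σ Path λ v → (p ≡ u ++ N ∷ E ∷ v) × (length u + 1 ≡ c)

NonMixed : Path → Path → Set
NonMixed P Q =
  ¬ (Σ ℕ λ a → Σ ℕ λ b →
       UpperCornerAt Q a × LowerCornerAt P b ×
       xAt Q a < xAt P b × yAt P b < yAt Q a)

data Letter : Set where
  C R S T : Letter

Word : Set
Word = List Letter

dup : Step → List Step → List Step
dup N []       = N ∷ []
dup N (N ∷ xs) = N ∷ N ∷ xs
dup N (E ∷ xs) = E ∷ dup N xs
dup E []       = E ∷ []
dup E (E ∷ xs) = E ∷ E ∷ xs
dup E (N ∷ xs) = N ∷ dup E xs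

-- duplicate the last occurrence of s, i.e. insert s before the final
-- maximal run of the other letter
dupLast : Step → Path → Path
dupLast s p = reverse (dup s (reverse p))

insBeforeLast : Step → Path → Path
insBeforeLast x p with reverse p
... | []     = x ∷ []
... | y ∷ ys = reverse (y ∷ x ∷ ys)

Diagram : Set
Diagram = Path × Path

-- R: new row on top over the same columns as the topmost row
-- C: new column on the right over the same rows as the rightmost column
-- S: one square right of the topmost row
-- T: one square above the rightmost column
apply : Letter → Diagram → Diagram
apply R (P , Q) = (P ++ N ∷ [] , dupLast N Q)
apply C (P , Q) = (dupLast E P , Q ++ E ∷ [])
apply S (P , Q) = (insBeforeLast E P , Q ++ E ∷ [])
apply T (P , Q) = (P ++ N ∷ [] , insBeforeLast N Q)

unitSquare : Diagram
unitSquare = (E ∷ N ∷ [] , N ∷ E ∷ [])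

run : Diagram → Word → Diagram
run d []      = d
run d (c ∷ w) = run (apply c d) w

D : Word → Diagram
D w = run unitSquare w

-- w_j = c  (1-indexed)
LetterAt : Word → ℕ → Letter → Set
LetterAt w j c = Σ Word λ u → Σ Word λ v → (w ≡ u ++ c ∷ v) × (length u + 1 ≡ j)

Factor : Word → Word → Set
Factor f w = Σ Word λ u → Σ Word λ v → w ≡ u ++ f ++ v

Good : Word → Set
Good w =
  (∀ j → LetterAt w j S ⇔ LowerCornerAt (proj₁ (D w)) j) ×
  (∀ j → LetterAt w j T ⇔ UpperCornerAt (proj₂ (D w)) j) ×
  ¬ Factor (R ∷ C ∷ []) w

{-# OPTIONS --safe #-}
module Submission where

-- Read a diagram backwards from its end point (m , r).  The last letter of a good word is
-- forced by the shape there: a lower corner just before the end means S, an upper corner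
-- means T, and otherwise the top row or the rightmost column repeats its neighbour, giving
-- R or C; when both do, the ban on RC forces R.  Undoing that letter leaves a smaller
-- non-mixed diagram, because the only end shape where no letter can be undone contains a
-- mixed pair of corners.  Induction on the size then gives existence and uniqueness.  SS and
-- TT never occur: after undoing S (resp. T) there is no corner left at the new end point for
-- another S (resp. T).
--
-- Formally the word and both paths are reversed, so that every letter acts at the front of
-- the lists; the superscript ᴿ marks notions stated for reversed paths.

open import Defs
open import Data.List using (List; []; _∷_; _++_; length; reverse; replicate; foldr; foldl)
open import Data.List.Properties
  using (reverse-++; reverse-involutive; length-reverse; length-++; ++-assoc; unfold-reverse;
         ∷-injectiveʳ; ∷-injectiveˡ; foldr-ʳ++)
open import Data.Nat using (ℕ; zero; suc; _+_; _∸_; _≤_; _<_; z≤n; s≤s)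
open import Data.Nat.Properties
open import Data.Nat.Tactic.RingSolver using (solve-∀)
open import Data.Product using (Σ; ∃-syntax; _×_; _,_; proj₁; proj₂)
open import Data.Sum using (inj₁; inj₂)
open import Data.Empty using (⊥; ⊥-elim)
open import Function.Base using (flip; _∘_)
open import Function.Bundles using (_⇔_; mk⇔; Equivalence)
open import Function.Properties.Equivalence using () renaming (trans to ⇔-trans; sym to ⇔-sym)
open import Relation.Binary.PropositionalEquality
open import Relation.Nullary using (¬_)
open Equivalence using (to; from)

#E #N : Path → ℕ
#E []      = 0
#E (E ∷ l) = suc (#E l)
#E (N ∷ l) = #E l
#N []      = 0
#N (N ∷ l) = suc (#N l)
#N (E ∷ l) = #N l

#E-++ : ∀ a b → #E (a ++ b) ≡ #E a + #E b
#E-++ []      b = refl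
#E-++ (E ∷ a) b = cong suc (#E-++ a b)
#E-++ (N ∷ a) b = #E-++ a b

#N-++ : ∀ a b → #N (a ++ b) ≡ #N a + #N b
#N-++ []      b = refl
#N-++ (N ∷ a) b = cong suc (#N-++ a b)
#N-++ (E ∷ a) b = #N-++ a b

#E+#N≡length : ∀ l → #E l + #N l ≡ length l
#E+#N≡length []      = refl
#E+#N≡length (E ∷ l) = cong suc (#E+#N≡length l)
#E+#N≡length (N ∷ l) = trans (+-suc (#E l) (#N l)) (cong suc (#E+#N≡length l))

additive-reverse : {A : Set} (f : List A → ℕ) → (∀ a b → f (a ++ b) ≡ f a + f b) →
                   ∀ l → f (reverse l) ≡ f l
additive-reverse f f-++ []      = refl
additive-reverse f f-++ (x ∷ l) = begin
  f (reverse (x ∷ l))         ≡⟨ cong f (unfold-reverse x l) ⟩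
  f (reverse l ++ x ∷ [])     ≡⟨ f-++ (reverse l) (x ∷ []) ⟩
  f (reverse l) + f (x ∷ [])  ≡⟨ cong (_+ f (x ∷ [])) (additive-reverse f f-++ l) ⟩
  f l + f (x ∷ [])            ≡⟨ +-comm (f l) _ ⟩
  f (x ∷ []) + f l            ≡⟨ f-++ (x ∷ []) l ⟨
  f (x ∷ l)                   ∎
  where open ≡-Reasoning

#E-reverse : ∀ l → #E (reverse l) ≡ #E l
#E-reverse = additive-reverse #E #E-++

#N-reverse : ∀ l → #N (reverse l) ≡ #N l
#N-reverse = additive-reverse #N #N-++

#E-dup-N : ∀ q → #E (dup N q) ≡ #E q
#E-dup-N []      = refl
#E-dup-N (N ∷ q) = refl
#E-dup-N (E ∷ q) = cong suc (#E-dup-N q)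

#E-dup-E : ∀ p → #E (dup E p) ≡ suc (#E p)
#E-dup-E []      = refl
#E-dup-E (E ∷ p) = refl
#E-dup-E (N ∷ p) = #E-dup-E p

#E-replicate-N : ∀ k → #E (replicate k N) ≡ 0
#E-replicate-N zero    = refl
#E-replicate-N (suc k) = #E-replicate-N k

#N-replicate-E : ∀ l → #N (replicate l E) ≡ 0
#N-replicate-E zero    = refl
#N-replicate-E (suc l) = #N-replicate-E l

eastsIn-length : ∀ l → eastsIn (length l) l ≡ #E l
eastsIn-length []      = refl
eastsIn-length (E ∷ l) = cong suc (eastsIn-length l)
eastsIn-length (N ∷ l) = eastsIn-length l

eastsIn-prefix : ∀ a b → eastsIn (length a) (a ++ b) ≡ #E a
eastsIn-prefix []      b = refl
eastsIn-prefix (E ∷ a) b = cong suc (eastsIn-prefix a b)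
eastsIn-prefix (N ∷ a) b = eastsIn-prefix a b

eastsIn≤ : ∀ j l → eastsIn j l ≤ j
eastsIn≤ zero    l       = z≤n
eastsIn≤ (suc j) []      = z≤n
eastsIn≤ (suc j) (E ∷ l) = s≤s (eastsIn≤ j l)
eastsIn≤ (suc j) (N ∷ l) = m≤n⇒m≤1+n (eastsIn≤ j l)

eastsIn-replicate-E : ∀ j m x → j ≤ m → eastsIn j (replicate m E ++ x) ≡ j
eastsIn-replicate-E zero    m       x _       = refl
eastsIn-replicate-E (suc j) (suc m) x (s≤s h) = cong suc (eastsIn-replicate-E j m x h)

eastsIn-replicate-N : ∀ j m x → j ≤ m → eastsIn j (replicate m N ++ x) ≡ 0
eastsIn-replicate-N zero    m       x _       = refl
eastsIn-replicate-N (suc j) (suc m) x (s≤s h) = eastsIn-replicate-N j m x h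

module _ {A : Set} where

  OccursAt : List A → ℕ → List A → Set
  OccursAt pat i l = Σ (List A) λ u → Σ (List A) λ v → l ≡ u ++ pat ++ v × length u ≡ i

  -- Counted from 1, as in LetterAt, UpperCornerAt and LowerCornerAt.
  OccursAt⁺ : List A → ℕ → List A → Set
  OccursAt⁺ pat j l = Σ (List A) λ u → Σ (List A) λ v → l ≡ u ++ pat ++ v × length u + 1 ≡ j

  occursAt-suc : ∀ {pat x l i} → OccursAt pat (suc i) (x ∷ l) ⇔ OccursAt pat i l
  occursAt-suc {x = x} =
    mk⇔ shrink (λ (u , v , eq , len) → x ∷ u , v , cong (x ∷_) eq , cong suc len)
    where
    shrink : ∀ {pat l i} → OccursAt pat (suc i) (x ∷ l) → OccursAt pat i l
    shrink (_ ∷ u , v , eq , len) = u , v , ∷-injectiveʳ eq , suc-injective len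

  occursAt-zero : ∀ {pat l} → OccursAt pat 0 l → ∃[ t ] l ≡ pat ++ t
  occursAt-zero ([] , t , eq , _) = t , eq

  occursAt-prefix : ∀ pat t → OccursAt pat 0 (pat ++ t)
  occursAt-prefix pat t = [] , t , refl , refl

  ¬occursAt-zero : ∀ {pat l} → (∀ t → l ≢ pat ++ t) → ¬ OccursAt pat 0 l
  ¬occursAt-zero l≢ o = let (t , eq) = occursAt-zero o in l≢ t eq

  ¬occursAt-one : ∀ {pat a l} → (∀ t → l ≢ pat ++ t) → ¬ OccursAt pat 1 (a ∷ l)
  ¬occursAt-one l≢ = ¬occursAt-zero l≢ ∘ to occursAt-suc

  occursAt-[] : ∀ {x pat i} → ¬ OccursAt (x ∷ pat) i []
  occursAt-[] ([]    , _ , () , _)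
  occursAt-[] (_ ∷ _ , _ , () , _)

  length-split : ∀ {l} (u m v : List A) → l ≡ u ++ m ++ v →
                 length l ≡ length u + length m + length v
  length-split u m v refl = begin
    length (u ++ m ++ v)              ≡⟨ length-++ u ⟩
    length u + length (m ++ v)        ≡⟨ cong (length u +_) (length-++ m) ⟩
    length u + (length m + length v)  ≡⟨ +-assoc (length u) _ _ ⟨
    length u + length m + length v    ∎
    where open ≡-Reasoning

  reverse-split : ∀ {l} (u m v : List A) → l ≡ u ++ m ++ v →
                  reverse l ≡ reverse v ++ reverse m ++ reverse u
  reverse-split u m v refl = begin
    reverse (u ++ m ++ v)                  ≡⟨ reverse-++ u (m ++ v) ⟩
    reverse (m ++ v) ++ reverse u          ≡⟨ cong (_++ reverse u) (reverse-++ m v) ⟩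
    (reverse v ++ reverse m) ++ reverse u  ≡⟨ ++-assoc (reverse v) _ _ ⟩
    reverse v ++ reverse m ++ reverse u    ∎
    where open ≡-Reasoning

  occursAt-bound : ∀ {pat i l} → OccursAt pat i l → i + length pat ≤ length l
  occursAt-bound {pat} (u , v , eq , refl) =
    subst (length u + length pat ≤_) (sym (length-split u pat v eq)) (m≤m+n _ (length v))

  OccursInReverse : List A → ℕ → List A → Set
  OccursInReverse pat j l =
    ∃[ k ] OccursAt (reverse pat) k (reverse l) × k + length pat + j ≡ suc (length l)

  occursAt⁺⇔reverse : ∀ pat j l → OccursAt⁺ pat j l ⇔ OccursInReverse pat j l
  occursAt⁺⇔reverse pat j l = mk⇔ forth back
    where
    forth : OccursAt⁺ pat j l → OccursInReverse pat j l
    forth (u , v , eq , refl) =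
      length v , (reverse v , reverse u , reverse-split u pat v eq , length-reverse v) ,
      trans (reorder (length u) (length pat) (length v)) (cong suc (sym (length-split u pat v eq)))
      where
      reorder : ∀ a b c → c + b + (a + 1) ≡ suc (a + b + c)
      reorder = solve-∀
    back : OccursInReverse pat j l → OccursAt⁺ pat j l
    back (k , (a , b , eq , refl) , e) =
      reverse b , reverse a , l≡ , +-cancelˡ-≡ (length a + length pat) _ _ (begin
        length a + length pat + (length (reverse b) + 1)
          ≡⟨ cong (λ m → length a + length pat + (m + 1)) (length-reverse b) ⟩
        length a + length pat + (length b + 1)
          ≡⟨ cong (length a + length pat +_) (+-comm (length b) 1) ⟩
        length a + length pat + suc (length b)
          ≡⟨ +-suc _ _ ⟩
        suc (length a + length pat + length b)
          ≡⟨ cong suc length-l ⟨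
        suc (length l)
          ≡⟨ e ⟨
        length a + length pat + j ∎)
      where
      open ≡-Reasoning
      l≡ : l ≡ reverse b ++ pat ++ reverse a
      l≡ = trans (sym (reverse-involutive l))
             (trans (reverse-split a (reverse pat) b eq)
               (cong (λ m → reverse b ++ m ++ reverse a) (reverse-involutive pat)))
      length-l : length l ≡ length a + length pat + length b
      length-l = trans (sym (length-reverse l))
                   (trans (length-split a (reverse pat) b eq)
                     (cong (λ m → length a + m + length b) (length-reverse pat)))

Factor-reverse : ∀ f w → Factor f w → Factor (reverse f) (reverse w)
Factor-reverse f w (u , v , eq) = reverse v , reverse u , reverse-split u f v eq

Factor⇔reverse : ∀ f w → Factor f w ⇔ Factor (reverse f) (reverse w)
Factor⇔reverse f w = mk⇔ (Factor-reverse f w)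
  (subst₂ Factor (reverse-involutive f) (reverse-involutive w)
   ∘ Factor-reverse (reverse f) (reverse w))

insSecond : Step → Path → Path
insSecond x []       = x ∷ []
insSecond x (y ∷ ys) = y ∷ x ∷ ys

applyᴿ : Letter → Diagram → Diagram
applyᴿ R (p , q) = (N ∷ p , dup N q)
applyᴿ C (p , q) = (dup E p , E ∷ q)
applyᴿ S (p , q) = (insSecond E p , E ∷ q)
applyᴿ T (p , q) = (N ∷ p , insSecond N q)

unitᴿ : Diagram
unitᴿ = (N ∷ E ∷ [] , E ∷ N ∷ [])

Dᴿ : Word → Diagram
Dᴿ = foldr applyᴿ unitᴿ

mirror : Diagram → Diagram
mirror (p , q) = (reverse p , reverse q)

mirror-involutive : ∀ d → mirror (mirror d) ≡ d
mirror-involutive (p , q) = cong₂ _,_ (reverse-involutive p) (reverse-involutive q)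

dupLast-reverse : ∀ s p → dupLast s (reverse p) ≡ reverse (dup s p)
dupLast-reverse s p = cong (reverse ∘ dup s) (reverse-involutive p)

insBeforeLast-reverse : ∀ x p → insBeforeLast x (reverse p) ≡ reverse (insSecond x p)
insBeforeLast-reverse x p =
  trans (unfold x (reverse p)) (cong (reverse ∘ insSecond x) (reverse-involutive p))
  where
  unfold : ∀ x p → insBeforeLast x p ≡ reverse (insSecond x (reverse p))
  unfold x p with reverse p
  ... | []     = refl
  ... | y ∷ ys = refl

apply-mirror : ∀ c d → apply c (mirror d) ≡ mirror (applyᴿ c d)
apply-mirror R (p , q) = cong₂ _,_ (sym (unfold-reverse N p)) (dupLast-reverse N q)
apply-mirror C (p , q) = cong₂ _,_ (dupLast-reverse E p) (sym (unfold-reverse E q))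
apply-mirror S (p , q) = cong₂ _,_ (insBeforeLast-reverse E p) (sym (unfold-reverse E q))
apply-mirror T (p , q) = cong₂ _,_ (sym (unfold-reverse N p)) (insBeforeLast-reverse N q)

run-mirror : ∀ d w → run (mirror d) w ≡ mirror (foldl (flip applyᴿ) d w)
run-mirror d []      = refl
run-mirror d (c ∷ w) =
  trans (cong (λ d′ → run d′ w) (apply-mirror c d)) (run-mirror (applyᴿ c d) w)

D≡mirror-Dᴿ : ∀ w → D w ≡ mirror (Dᴿ (reverse w))
D≡mirror-Dᴿ w = trans (run-mirror unitᴿ w) (cong mirror (sym (foldr-ʳ++ applyᴿ unitᴿ w)))

D-reverse : ∀ r → D (reverse r) ≡ mirror (Dᴿ r)
D-reverse r = trans (D≡mirror-Dᴿ (reverse r)) (cong (mirror ∘ Dᴿ) (reverse-involutive r))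

length-dup : ∀ s l → length (dup s l) ≡ suc (length l)
length-dup N []      = refl
length-dup N (N ∷ l) = refl
length-dup N (E ∷ l) = cong suc (length-dup N l)
length-dup E []      = refl
length-dup E (E ∷ l) = refl
length-dup E (N ∷ l) = cong suc (length-dup E l)

length-insSecond : ∀ x l → length (insSecond x l) ≡ suc (length l)
length-insSecond x []      = refl
length-insSecond x (y ∷ l) = refl

length-applyᴿ : ∀ c d → length (proj₁ (applyᴿ c d)) ≡ suc (length (proj₁ d))
                      × length (proj₂ (applyᴿ c d)) ≡ suc (length (proj₂ d))
length-applyᴿ R (p , q) = refl , length-dup N q
length-applyᴿ C (p , q) = length-dup E p , refl
length-applyᴿ S (p , q) = length-insSecond E p , refl
length-applyᴿ T (p , q) = refl , length-insSecond N q

length-Dᴿ : ∀ r → length (proj₁ (Dᴿ r)) ≡ length r + 2 × length (proj₂ (Dᴿ r)) ≡ length r + 2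
length-Dᴿ []      = refl , refl
length-Dᴿ (c ∷ r) =
  let (p₁ , q₁) = length-applyᴿ c (Dᴿ r) ; (p₀ , q₀) = length-Dᴿ r
  in trans p₁ (cong suc p₀) , trans q₁ (cong suc q₀)

dup-N-after-Es : ∀ l t → dup N (replicate l E ++ N ∷ t) ≡ replicate l E ++ N ∷ N ∷ t
dup-N-after-Es zero    t = refl
dup-N-after-Es (suc l) t = cong (E ∷_) (dup-N-after-Es l t)

dup-E-after-Ns : ∀ k t → dup E (replicate k N ++ E ∷ t) ≡ replicate k N ++ E ∷ E ∷ t
dup-E-after-Ns zero    t = refl
dup-E-after-Ns (suc k) t = cong (N ∷_) (dup-E-after-Ns k t)

EndShape : Diagram → Set
EndShape (p , q) = (∃[ k ] ∃[ t ] p ≡ replicate (suc k) N ++ E ∷ t)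
                 × (∃[ l ] ∃[ t ] q ≡ replicate (suc l) E ++ N ∷ t)

EndShape-applyᴿ : ∀ c d → EndShape d → EndShape (applyᴿ c d)
EndShape-applyᴿ R _ ((k , t , refl) , (l , u , refl)) =
  (suc k , t , refl) , (l , N ∷ u , dup-N-after-Es (suc l) u)
EndShape-applyᴿ C _ ((k , t , refl) , (l , u , refl)) =
  (k , E ∷ t , dup-E-after-Ns (suc k) t) , (suc l , u , refl)
EndShape-applyᴿ S _ ((k , t , refl) , (l , u , refl)) =
  (0 , replicate k N ++ E ∷ t , refl) , (suc l , u , refl)
EndShape-applyᴿ T _ ((k , t , refl) , (l , u , refl)) =
  (suc k , t , refl) , (0 , replicate l E ++ N ∷ u , refl)

EndShape-Dᴿ : ∀ r → EndShape (Dᴿ r)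
EndShape-Dᴿ []      = (0 , [] , refl) , (0 , [] , refl)
EndShape-Dᴿ (c ∷ r) = EndShape-applyᴿ c (Dᴿ r) (EndShape-Dᴿ r)

EndShape⇒no-corner₀ : ∀ {p q} → EndShape (p , q) →
  ¬ OccursAt (E ∷ N ∷ []) 0 p × ¬ OccursAt (N ∷ E ∷ []) 0 q
EndShape⇒no-corner₀ ((_ , _ , refl) , (_ , _ , refl)) =
  ¬occursAt-zero (λ _ ()) , ¬occursAt-zero (λ _ ())

-- The top row covers the same columns as the row below it.
TopRowRepeated : Diagram → Set
TopRowRepeated (p , q) =
  (∃[ x ] p ≡ N ∷ N ∷ x) × (∃[ l ] ∃[ y ] q ≡ replicate (suc l) E ++ N ∷ N ∷ y)

TopRowRepeated-R : ∀ d → EndShape d → TopRowRepeated (applyᴿ R d)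
TopRowRepeated-R _ ((k , t , refl) , (l , u , refl)) =
  (replicate k N ++ E ∷ t , refl) , (l , u , dup-N-after-Es (suc l) u)

TopRowRepeated-C : ∀ d → EndShape d → TopRowRepeated (applyᴿ C d) → TopRowRepeated d
TopRowRepeated-C (p , _) (_ , (_ , _ , refl)) ((_ , p≡) , (suc l , y , q≡)) =
  dup-E-NN p p≡ , (l , y , ∷-injectiveʳ q≡)
  where
  dup-E-NN : ∀ p {x} → dup E p ≡ N ∷ N ∷ x → ∃[ x′ ] p ≡ N ∷ N ∷ x′
  dup-E-NN (N ∷ N ∷ p) _ = p , refl
  dup-E-NN []          ()
  dup-E-NN (E ∷ _)     ()
  dup-E-NN (N ∷ [])    ()
  dup-E-NN (N ∷ E ∷ _) ()
TopRowRepeated-C _ (_ , (_ , _ , refl)) (_ , (zero , _ , ()))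

replicate-E-NN≢NE : ∀ l {y t} → replicate l E ++ N ∷ N ∷ y ≢ N ∷ E ∷ t
replicate-E-NN≢NE zero    ()
replicate-E-NN≢NE (suc l) ()

replicate-E-NE≢NN : ∀ a b {r y} → replicate a E ++ N ∷ E ∷ r ≢ replicate b E ++ N ∷ N ∷ y
replicate-E-NE≢NN zero    zero    ()
replicate-E-NE≢NN zero    (suc b) ()
replicate-E-NE≢NN (suc a) zero    ()
replicate-E-NE≢NN (suc a) (suc b) e = replicate-E-NE≢NN a b (∷-injectiveʳ e)

-- The letter rᵢ of the reversed word creates the corner reached after i + 1 steps of the
-- reversed paths.
Goodᴿ : Word → Diagram → Set
Goodᴿ r (p , q) =
  (∀ i → OccursAt (S ∷ []) i r ⇔ OccursAt (E ∷ N ∷ []) (suc i) p) ×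
  (∀ i → OccursAt (T ∷ []) i r ⇔ OccursAt (N ∷ E ∷ []) (suc i) q) ×
  ¬ Factor (C ∷ R ∷ []) r

reindex-∀⇔ : {A B A′ B′ : ℕ → Set} (n : ℕ) →
  (∀ j → A j ⇔ (∃[ i ] A′ i × i + j ≡ n)) → (∀ j → B j ⇔ (∃[ i ] B′ i × i + j ≡ n)) →
  (∀ {i} → A′ i → i ≤ n) → (∀ {i} → B′ i → i ≤ n) →
  (∀ j → A j ⇔ B j) ⇔ (∀ i → A′ i ⇔ B′ i)
reindex-∀⇔ n A⇔ B⇔ A′≤ B′≤ =
  mk⇔ (λ h i → mk⇔ (forth A⇔ B⇔ A′≤ (to ∘ h) i) (forth B⇔ A⇔ B′≤ (from ∘ h) i))
      (λ h j → mk⇔ (back A⇔ B⇔ (to ∘ h) j) (back B⇔ A⇔ (from ∘ h) j))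
  where
  forth : {X Y X′ Y′ : ℕ → Set} →
    (∀ j → X j ⇔ (∃[ i ] X′ i × i + j ≡ n)) → (∀ j → Y j ⇔ (∃[ i ] Y′ i × i + j ≡ n)) →
    (∀ {i} → X′ i → i ≤ n) → (∀ j → X j → Y j) → ∀ i → X′ i → Y′ i
  forth {Y′ = Y′} X⇔ Y⇔ X′≤ h i x′ =
    let (j , i+j≡n) = m≤n⇒∃[o]m+o≡n (X′≤ x′)
        (i′ , y′ , i′+j≡n) = to (Y⇔ j) (h j (from (X⇔ j) (i , x′ , i+j≡n)))
    in subst Y′ (+-cancelʳ-≡ j i′ i (trans i′+j≡n (sym i+j≡n))) y′
  back : {X Y X′ Y′ : ℕ → Set} →
    (∀ j → X j ⇔ (∃[ i ] X′ i × i + j ≡ n)) → (∀ j → Y j ⇔ (∃[ i ] Y′ i × i + j ≡ n)) →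
    (∀ i → X′ i → Y′ i) → ∀ j → X j → Y j
  back X⇔ Y⇔ h j x = let (i , x′ , i+j≡n) = to (X⇔ j) x in from (Y⇔ j) (i , h i x′ , i+j≡n)

letterAt⇔reverse : ∀ w c j →
  LetterAt w j c ⇔ (∃[ i ] OccursAt (c ∷ []) i (reverse w) × i + j ≡ length w)
letterAt⇔reverse w c j = ⇔-trans (occursAt⁺⇔reverse (c ∷ []) j w) (mk⇔
  (λ (i , o , e) → i , o , suc-injective (trans (sym (reorder i)) e))
  (λ (i , o , e) → i , o , trans (reorder i) (cong suc e)))
  where
  reorder : ∀ i → i + 1 + j ≡ suc (i + j)
  reorder i = cong (_+ j) (+-comm i 1)

cornerAt⇔reverse : ∀ (x y : Step) p n → length p ≡ n + 2 → ¬ OccursAt (y ∷ x ∷ []) 0 p → ∀ j →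
  OccursAt⁺ (x ∷ y ∷ []) j (reverse p) ⇔ (∃[ i ] OccursAt (y ∷ x ∷ []) (suc i) p × i + j ≡ n)
cornerAt⇔reverse x y p n len no₀ j =
  ⇔-trans (occursAt⁺⇔reverse (x ∷ y ∷ []) j (reverse p)) (mk⇔ forth back)
  where
  in-p : ∀ {k} → OccursAt (y ∷ x ∷ []) k (reverse (reverse p)) ⇔ OccursAt (y ∷ x ∷ []) k p
  in-p {k} = mk⇔ (subst (OccursAt _ k) (reverse-involutive p))
                 (subst (OccursAt _ k) (sym (reverse-involutive p)))
  length-rp : length (reverse p) ≡ n + 2
  length-rp = trans (length-reverse p) len
  reorder : ∀ i → suc i + 2 + j ≡ suc (length (reverse p)) ⇔ i + j ≡ n
  reorder i = mk⇔
    (λ e → +-cancelʳ-≡ 2 _ _ (trans (sym (shuffle i j)) (trans (suc-injective e) length-rp)))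
    (λ e → cong suc (trans (shuffle i j) (trans (cong (_+ 2) e) (sym length-rp))))
    where
    shuffle : ∀ i j → i + 2 + j ≡ i + j + 2
    shuffle = solve-∀
  forth : OccursInReverse (x ∷ y ∷ []) j (reverse p) →
          ∃[ i ] OccursAt (y ∷ x ∷ []) (suc i) p × i + j ≡ n
  forth (zero  , o , _) = ⊥-elim (no₀ (to in-p o))
  forth (suc i , o , e) = i , to in-p o , to (reorder i) e
  back : ∃[ i ] OccursAt (y ∷ x ∷ []) (suc i) p × i + j ≡ n →
         OccursInReverse (x ∷ y ∷ []) j (reverse p)
  back (i , o , e) = suc i , from in-p o , from (reorder i) e

Good⇔Goodᴿ : ∀ w → Good w ⇔ Goodᴿ (reverse w) (Dᴿ (reverse w))
Good⇔Goodᴿ w = mk⇔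
  (λ (s , t , rc) → to S-part s , to T-part t , rc ∘ from RC-part)
  (λ (s , t , rc) → from S-part s , from T-part t , rc ∘ to RC-part)
  where
  r : Word
  r = reverse w
  n : ℕ
  n = length w
  p q : Path
  p = proj₁ (Dᴿ r)
  q = proj₂ (Dᴿ r)
  length-p : length p ≡ n + 2
  length-p = trans (proj₁ (length-Dᴿ r)) (cong (_+ 2) (length-reverse w))
  length-q : length q ≡ n + 2
  length-q = trans (proj₂ (length-Dᴿ r)) (cong (_+ 2) (length-reverse w))
  no-corner₀ : ¬ OccursAt (E ∷ N ∷ []) 0 p × ¬ OccursAt (N ∷ E ∷ []) 0 q
  no-corner₀ = EndShape⇒no-corner₀ (EndShape-Dᴿ r)
  letter-bound : ∀ {c i} → OccursAt (c ∷ []) i r → i ≤ n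
  letter-bound o =
    ≤-trans (m≤m+n _ 1) (≤-trans (occursAt-bound o) (≤-reflexive (length-reverse w)))
  corner-bound : ∀ {l x y i} → length l ≡ n + 2 → OccursAt (x ∷ y ∷ []) (suc i) l → i ≤ n
  corner-bound len o =
    ≤-trans (n≤1+n _) (+-cancelʳ-≤ 2 _ n (≤-trans (occursAt-bound o) (≤-reflexive len)))
  S-part : (∀ j → LetterAt w j S ⇔ LowerCornerAt (proj₁ (D w)) j)
         ⇔ (∀ i → OccursAt (S ∷ []) i r ⇔ OccursAt (E ∷ N ∷ []) (suc i) p)
  S-part = reindex-∀⇔ n (letterAt⇔reverse w S) lower⇔ letter-bound (corner-bound length-p)
    where
    lower⇔ : ∀ j → LowerCornerAt (proj₁ (D w)) j
                 ⇔ (∃[ i ] OccursAt (E ∷ N ∷ []) (suc i) p × i + j ≡ n)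
    lower⇔ j rewrite cong proj₁ (D≡mirror-Dᴿ w) =
      cornerAt⇔reverse N E p n length-p (proj₁ no-corner₀) j
  T-part : (∀ j → LetterAt w j T ⇔ UpperCornerAt (proj₂ (D w)) j)
         ⇔ (∀ i → OccursAt (T ∷ []) i r ⇔ OccursAt (N ∷ E ∷ []) (suc i) q)
  T-part = reindex-∀⇔ n (letterAt⇔reverse w T) upper⇔ letter-bound (corner-bound length-q)
    where
    upper⇔ : ∀ j → UpperCornerAt (proj₂ (D w)) j
                 ⇔ (∃[ i ] OccursAt (N ∷ E ∷ []) (suc i) q × i + j ≡ n)
    upper⇔ j rewrite cong proj₂ (D≡mirror-Dᴿ w) =
      cornerAt⇔reverse E N q n length-q (proj₂ no-corner₀) j
  RC-part : Factor (R ∷ C ∷ []) w ⇔ Factor (C ∷ R ∷ []) r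
  RC-part = Factor⇔reverse (R ∷ C ∷ []) w

Good-reverse : ∀ r → Good (reverse r) ⇔ Goodᴿ r (Dᴿ r)
Good-reverse r = subst (λ r′ → Good (reverse r) ⇔ Goodᴿ r′ (Dᴿ r′)) (reverse-involutive r)
                       (Good⇔Goodᴿ (reverse r))

occursAt-insSecond : ∀ x p {y pat i} →
  OccursAt (y ∷ pat) (2 + i) (insSecond x p) ⇔ OccursAt (y ∷ pat) (suc i) p
occursAt-insSecond x []      = mk⇔ (⊥-elim ∘ occursAt-[] ∘ to occursAt-suc) (⊥-elim ∘ occursAt-[])
occursAt-insSecond x (_ ∷ p) = ⇔-trans occursAt-suc (⇔-trans occursAt-suc (⇔-sym occursAt-suc))

occursAt-dup-N : ∀ p k → OccursAt (N ∷ E ∷ []) (suc k) (dup N p) ⇔ OccursAt (N ∷ E ∷ []) k p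
occursAt-dup-N []      k       = mk⇔ (⊥-elim ∘ occursAt-[] ∘ to occursAt-suc) (⊥-elim ∘ occursAt-[])
occursAt-dup-N (N ∷ p) k       = occursAt-suc
occursAt-dup-N (E ∷ p) zero    =
  mk⇔ (⊥-elim ∘ ¬occursAt-one (no-NE p)) (⊥-elim ∘ ¬occursAt-zero (λ _ ()))
  where
  no-NE : ∀ p t → dup N p ≢ N ∷ E ∷ t
  no-NE []      _ ()
  no-NE (N ∷ p) _ ()
  no-NE (E ∷ p) _ ()
occursAt-dup-N (E ∷ p) (suc k) =
  ⇔-trans occursAt-suc (⇔-trans (occursAt-dup-N p k) (⇔-sym occursAt-suc))

occursAt-dup-E : ∀ p k → OccursAt (E ∷ N ∷ []) (suc k) (dup E p) ⇔ OccursAt (E ∷ N ∷ []) k p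
occursAt-dup-E []      k       = mk⇔ (⊥-elim ∘ occursAt-[] ∘ to occursAt-suc) (⊥-elim ∘ occursAt-[])
occursAt-dup-E (E ∷ p) k       = occursAt-suc
occursAt-dup-E (N ∷ p) zero    =
  mk⇔ (⊥-elim ∘ ¬occursAt-one (no-EN p)) (⊥-elim ∘ ¬occursAt-zero (λ _ ()))
  where
  no-EN : ∀ p t → dup E p ≢ E ∷ N ∷ t
  no-EN []      _ ()
  no-EN (E ∷ p) _ ()
  no-EN (N ∷ p) _ ()
occursAt-dup-E (N ∷ p) (suc k) =
  ⇔-trans occursAt-suc (⇔-trans (occursAt-dup-E p k) (⇔-sym occursAt-suc))

lower-corners-applyᴿ : ∀ c d i →
  OccursAt (E ∷ N ∷ []) (2 + i) (proj₁ (applyᴿ c d)) ⇔ OccursAt (E ∷ N ∷ []) (suc i) (proj₁ d)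
lower-corners-applyᴿ R d i = occursAt-suc
lower-corners-applyᴿ C d i = occursAt-dup-E (proj₁ d) (suc i)
lower-corners-applyᴿ S d i = occursAt-insSecond E (proj₁ d)
lower-corners-applyᴿ T d i = occursAt-suc

upper-corners-applyᴿ : ∀ c d i →
  OccursAt (N ∷ E ∷ []) (2 + i) (proj₂ (applyᴿ c d)) ⇔ OccursAt (N ∷ E ∷ []) (suc i) (proj₂ d)
upper-corners-applyᴿ R d i = occursAt-dup-N (proj₂ d) (suc i)
upper-corners-applyᴿ C d i = occursAt-suc
upper-corners-applyᴿ S d i = occursAt-suc
upper-corners-applyᴿ T d i = occursAt-insSecond N (proj₂ d)

GoodHead : Letter → Word → Diagram → Set
GoodHead c r (p , q) =
  (c ≡ S ⇔ OccursAt (E ∷ N ∷ []) 1 p) ×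
  (c ≡ T ⇔ OccursAt (N ∷ E ∷ []) 1 q) ×
  (c ≡ C → ∀ r′ → r ≢ R ∷ r′)

letterAt-zero : ∀ {c x : Letter} {r} → OccursAt (x ∷ []) 0 (c ∷ r) ⇔ c ≡ x
letterAt-zero {r = r} =
  mk⇔ (λ o → ∷-injectiveˡ (proj₂ (occursAt-zero o))) (λ { refl → occursAt-prefix _ r })

Goodᴿ-∷ : ∀ c r d → Goodᴿ (c ∷ r) (applyᴿ c d) ⇔ (Goodᴿ r d × GoodHead c r (applyᴿ c d))
Goodᴿ-∷ c r d = mk⇔
  (λ (gS , gT , noCR) →
     ( (λ i → ⇔-trans (⇔-sym occursAt-suc) (⇔-trans (gS (suc i)) (lower-corners-applyᴿ c d i)))
     , (λ i → ⇔-trans (⇔-sym occursAt-suc) (⇔-trans (gT (suc i)) (upper-corners-applyᴿ c d i)))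
     , λ (u , v , eq) → noCR (c ∷ u , v , cong (c ∷_) eq) )
   , ( ⇔-trans (⇔-sym letterAt-zero) (gS 0) , ⇔-trans (⇔-sym letterAt-zero) (gT 0)
     , λ { refl r′ refl → noCR ([] , r′ , refl) } ))
  (λ ((gS , gT , noCR) , (hS , hT , hC)) →
     ( (λ { zero    → ⇔-trans letterAt-zero hS
          ; (suc i) → ⇔-trans occursAt-suc (⇔-trans (gS i) (⇔-sym (lower-corners-applyᴿ c d i))) })
     , (λ { zero    → ⇔-trans letterAt-zero hT
          ; (suc i) → ⇔-trans occursAt-suc (⇔-trans (gT i) (⇔-sym (upper-corners-applyᴿ c d i))) })
     , λ { ([] , v , eq)    → hC (∷-injectiveˡ eq) v (∷-injectiveʳ eq)
         ; (_ ∷ u , v , eq) → noCR (u , v , ∷-injectiveʳ eq) } ))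

Goodᴿ-tail : ∀ c r → Goodᴿ (c ∷ r) (Dᴿ (c ∷ r)) → Goodᴿ r (Dᴿ r)
Goodᴿ-tail c r = proj₁ ∘ to (Goodᴿ-∷ c r (Dᴿ r))

Goodᴿ-head : ∀ c r → Goodᴿ (c ∷ r) (Dᴿ (c ∷ r)) → GoodHead c r (Dᴿ (c ∷ r))
Goodᴿ-head c r = proj₂ ∘ to (Goodᴿ-∷ c r (Dᴿ r))

dup-injective : ∀ s {l l′} → dup s l ≡ dup s l′ → l ≡ l′
dup-injective N {[]}    {[]}     _    = refl
dup-injective N {[]}    {N ∷ _}  ()
dup-injective N {[]}    {E ∷ _}  ()
dup-injective N {N ∷ _} {[]}     ()
dup-injective N {N ∷ _} {N ∷ _}  refl = refl
dup-injective N {N ∷ _} {E ∷ _}  ()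
dup-injective N {E ∷ _} {[]}     ()
dup-injective N {E ∷ _} {N ∷ _}  ()
dup-injective N {E ∷ _} {E ∷ _}  e    = cong (E ∷_) (dup-injective N (∷-injectiveʳ e))
dup-injective E {[]}    {[]}     _    = refl
dup-injective E {[]}    {E ∷ _}  ()
dup-injective E {[]}    {N ∷ _}  ()
dup-injective E {E ∷ _} {[]}     ()
dup-injective E {E ∷ _} {E ∷ _}  refl = refl
dup-injective E {E ∷ _} {N ∷ _}  ()
dup-injective E {N ∷ _} {[]}     ()
dup-injective E {N ∷ _} {E ∷ _}  ()
dup-injective E {N ∷ _} {N ∷ _}  e    = cong (N ∷_) (dup-injective E (∷-injectiveʳ e))

insSecond-injective : ∀ x {l l′} → insSecond x l ≡ insSecond x l′ → l ≡ l′
insSecond-injective x {[]}    {[]}    _    = refl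
insSecond-injective x {[]}    {_ ∷ _} ()
insSecond-injective x {_ ∷ _} {[]}    ()
insSecond-injective x {_ ∷ _} {_ ∷ _} refl = refl

applyᴿ-injective : ∀ c {d d′} → applyᴿ c d ≡ applyᴿ c d′ → d ≡ d′
applyᴿ-injective R e = cong₂ _,_ (∷-injectiveʳ (cong proj₁ e)) (dup-injective N (cong proj₂ e))
applyᴿ-injective C e = cong₂ _,_ (dup-injective E (cong proj₁ e)) (∷-injectiveʳ (cong proj₂ e))
applyᴿ-injective S e =
  cong₂ _,_ (insSecond-injective E (cong proj₁ e)) (∷-injectiveʳ (cong proj₂ e))
applyᴿ-injective T e =
  cong₂ _,_ (∷-injectiveʳ (cong proj₁ e)) (insSecond-injective N (cong proj₂ e))

Dᴿ-∷≢unitᴿ : ∀ c r → Dᴿ (c ∷ r) ≢ unitᴿ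
Dᴿ-∷≢unitᴿ c r e
  with () ← +-cancelʳ-≡ 2 (suc (length r)) 0
              (trans (sym (proj₁ (length-Dᴿ (c ∷ r)))) (cong (length ∘ proj₁) e))

TopRowRepeated⇒R : ∀ r → Goodᴿ r (Dᴿ r) → TopRowRepeated (Dᴿ r) → ∃[ r′ ] r ≡ R ∷ r′
TopRowRepeated⇒R []      _ ((_ , ()) , _)
TopRowRepeated⇒R (R ∷ r) _ _ = r , refl
TopRowRepeated⇒R (S ∷ r) g ((_ , p≡) , _) = ⊥-elim (¬occursAt-one (λ _ ())
  (subst (OccursAt (E ∷ N ∷ []) 1) p≡ (to (proj₁ (Goodᴿ-head S r g)) refl)))
TopRowRepeated⇒R (T ∷ r) g (_ , (l , _ , q≡)) = ⊥-elim (¬occursAt-one (λ _ → replicate-E-NN≢NE l)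
  (subst (OccursAt (N ∷ E ∷ []) 1) q≡ (to (proj₁ (proj₂ (Goodᴿ-head T r g))) refl)))
TopRowRepeated⇒R (C ∷ r) g top =
  let (r′ , r≡) = TopRowRepeated⇒R r (Goodᴿ-tail C r g)
                    (TopRowRepeated-C (Dᴿ r) (EndShape-Dᴿ r) top)
  in ⊥-elim (proj₂ (proj₂ (Goodᴿ-head C r g)) refl r′ r≡)

-- When both the top row and the rightmost column could be undone, the ban on RC forces R.
Dᴿ-R∷≢C∷ : ∀ r r′ → Goodᴿ (C ∷ r′) (Dᴿ (C ∷ r′)) → Dᴿ (R ∷ r) ≢ Dᴿ (C ∷ r′)
Dᴿ-R∷≢C∷ r r′ g e
  with () ← TopRowRepeated⇒R (C ∷ r′) g
              (subst TopRowRepeated e (TopRowRepeated-R (Dᴿ r) (EndShape-Dᴿ r)))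

letter-≡ : ∀ {c c′} → (c ≡ S ⇔ c′ ≡ S) → (c ≡ T ⇔ c′ ≡ T) →
  ¬ (c ≡ R × c′ ≡ C) → ¬ (c ≡ C × c′ ≡ R) → c ≡ c′
letter-≡ {R} {R} _ _ _  _  = refl
letter-≡ {C} {C} _ _ _  _  = refl
letter-≡ {S} {_} s _ _  _  = sym (to s refl)
letter-≡ {_} {S} s _ _  _  = from s refl
letter-≡ {T} {_} _ t _  _  = sym (to t refl)
letter-≡ {_} {T} _ t _  _  = from t refl
letter-≡ {R} {C} _ _ rc _  = ⊥-elim (rc (refl , refl))
letter-≡ {C} {R} _ _ _  cr = ⊥-elim (cr (refl , refl))

Goodᴿ-head-≡ : ∀ c c′ r r′ → Goodᴿ (c ∷ r) (Dᴿ (c ∷ r)) → Goodᴿ (c′ ∷ r′) (Dᴿ (c′ ∷ r′)) →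
  Dᴿ (c ∷ r) ≡ Dᴿ (c′ ∷ r′) → c ≡ c′
Goodᴿ-head-≡ c c′ r r′ g g′ e =
  letter-≡ (⇔-trans (proj₁ head) (⇔-sym (proj₁ head′)))
           (⇔-trans (proj₁ (proj₂ head)) (⇔-sym (proj₁ (proj₂ head′))))
           (λ { (refl , refl) → Dᴿ-R∷≢C∷ r r′ g′ e })
           (λ { (refl , refl) → Dᴿ-R∷≢C∷ r′ r g (sym e) })
  where
  head : GoodHead c r (Dᴿ (c ∷ r))
  head = Goodᴿ-head c r g
  head′ : GoodHead c′ r′ (Dᴿ (c ∷ r))
  head′ = subst (GoodHead c′ r′) (sym e) (Goodᴿ-head c′ r′ g′)

Goodᴿ-unique : ∀ r r′ → Goodᴿ r (Dᴿ r) → Goodᴿ r′ (Dᴿ r′) → Dᴿ r ≡ Dᴿ r′ → r ≡ r′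
Goodᴿ-unique []      []        _ _  _ = refl
Goodᴿ-unique []      (c′ ∷ r′) _ _  e = ⊥-elim (Dᴿ-∷≢unitᴿ c′ r′ (sym e))
Goodᴿ-unique (c ∷ r) []        _ _  e = ⊥-elim (Dᴿ-∷≢unitᴿ c r e)
Goodᴿ-unique (c ∷ r) (c′ ∷ r′) g g′ e with refl ← Goodᴿ-head-≡ c c′ r r′ g g′ e =
  cong (c ∷_) (Goodᴿ-unique r r′ (Goodᴿ-tail c r g) (Goodᴿ-tail c r′ g′) (applyᴿ-injective c e))

-- IsDiagram and NonMixed for the reversed paths; corner coordinates are measured from (m , r).
IsDiagramᴿ : Path → Path → Set
IsDiagramᴿ p q =
  length p ≡ length q × #E p ≡ #E q × (∀ j → 0 < j → j < length p → eastsIn j p < eastsIn j q)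

NonMixedᴿ : Path → Path → Set
NonMixedᴿ p q = ∀ u v u′ v′ → q ≡ u ++ N ∷ E ∷ v → p ≡ u′ ++ E ∷ N ∷ v′ →
  suc (#E u′) < #E u → suc (#N u) < #N u′ → ⊥

IsDiagramᴿ⇒#N≡ : ∀ {p q} → IsDiagramᴿ p q → #N p ≡ #N q
IsDiagramᴿ⇒#N≡ {p} {q} (le , ee , _) = +-cancelˡ-≡ (#E p) _ _ (begin
  #E p + #N p  ≡⟨ #E+#N≡length p ⟩
  length p     ≡⟨ le ⟩
  length q     ≡⟨ #E+#N≡length q ⟨
  #E q + #N q  ≡⟨ cong (_+ #N q) ee ⟨
  #E p + #N q  ∎)
  where open ≡-Reasoning

IsDiagramᴿ-starts : ∀ {x x′ y p q} → IsDiagramᴿ (x ∷ y ∷ p) (x′ ∷ q) → x ≡ N × x′ ≡ E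
IsDiagramᴿ-starts {x} {x′} (_ , _ , st) = first-steps x x′ (st 1 (s≤s z≤n) (s≤s (s≤s z≤n)))
  where
  first-steps : ∀ x x′ {l l′} → eastsIn 1 (x ∷ l) < eastsIn 1 (x′ ∷ l′) → x ≡ N × x′ ≡ E
  first-steps N E _ = refl , refl
  first-steps E E (s≤s ())
  first-steps E N ()
  first-steps N N ()

Realisation : Diagram → Set
Realisation d =
  Σ Word λ r → Dᴿ r ≡ d × Goodᴿ r (Dᴿ r) × ¬ Factor (S ∷ S ∷ []) r × ¬ Factor (T ∷ T ∷ []) r

¬Factor-xx-∷ : ∀ {x c : Letter} {r} → (c ≡ x → ¬ OccursAt (x ∷ []) 0 r) →
  ¬ Factor (x ∷ x ∷ []) r → ¬ Factor (x ∷ x ∷ []) (c ∷ r)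
¬Factor-xx-∷ head-x no-xx ([] , v , eq) =
  head-x (∷-injectiveˡ eq) (subst (OccursAt _ 0) (sym (∷-injectiveʳ eq)) (occursAt-prefix _ v))
¬Factor-xx-∷ head-x no-xx (_ ∷ u , v , eq) = no-xx (u , v , ∷-injectiveʳ eq)

Realisation-applyᴿ : ∀ c {d′ d} → applyᴿ c d′ ≡ d → Realisation d′ →
  (c ≡ S ⇔ OccursAt (E ∷ N ∷ []) 1 (proj₁ d)) → (c ≡ T ⇔ OccursAt (N ∷ E ∷ []) 1 (proj₂ d)) →
  (c ≡ C → ¬ TopRowRepeated d′) →
  (c ≡ S → ¬ OccursAt (E ∷ N ∷ []) 1 (proj₁ d′)) → (c ≡ T → ¬ OccursAt (N ∷ E ∷ []) 1 (proj₂ d′)) →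
  Realisation d
Realisation-applyᴿ c refl (r , refl , g@(gS , gT , _) , no-SS , no-TT) hS hT hC nS nT =
  c ∷ r , refl , from (Goodᴿ-∷ c r (Dᴿ r)) (g , hS , hT , no-RC) ,
  ¬Factor-xx-∷ (λ c≡S → nS c≡S ∘ to (gS 0)) no-SS ,
  ¬Factor-xx-∷ (λ c≡T → nT c≡T ∘ to (gT 0)) no-TT
  where
  no-RC : c ≡ C → ∀ r′ → r ≢ R ∷ r′
  no-RC c≡C r′ refl = hC c≡C (TopRowRepeated-R (Dᴿ r′) (EndShape-Dᴿ r′))

Realisable : ℕ → Set
Realisable n = ∀ p q → length p ≡ 2 + n → IsDiagramᴿ p q → NonMixedᴿ p q → Realisation (p , q)

RealisableGiven : ℕ → Path → Path → Set
RealisableGiven n p q =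
  Realisable n → length p ≡ 3 + n → IsDiagramᴿ p q → NonMixedᴿ p q → Realisation (p , q)

eastsIn-dup-N : ∀ j m r → m < j →
  eastsIn j (replicate m E ++ N ∷ r) ≡ eastsIn (suc j) (replicate m E ++ N ∷ N ∷ r)
eastsIn-dup-N (suc j) zero    r _       = refl
eastsIn-dup-N (suc j) (suc m) r (s≤s h) = cong suc (eastsIn-dup-N j m r h)

eastsIn-dup-E : ∀ j m r → m < j →
  eastsIn (suc j) (replicate m N ++ E ∷ E ∷ r) ≡ suc (eastsIn j (replicate m N ++ E ∷ r))
eastsIn-dup-E (suc j) zero    r _       = refl
eastsIn-dup-E (suc j) (suc m) r (s≤s h) = eastsIn-dup-E j m r h

dup-N-before : ∀ u y v → ∃[ u₂ ] dup N (u ++ N ∷ y ∷ v) ≡ u₂ ++ N ∷ y ∷ v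
                               × #E u₂ ≡ #E u × #N u₂ ≡ suc (#N u)
dup-N-before []      y v = N ∷ [] , refl , refl , refl
dup-N-before (N ∷ u) y v = N ∷ N ∷ u , refl , refl , refl
dup-N-before (E ∷ u) y v =
  let (u₂ , e , #E≡ , #N≡) = dup-N-before u y v in E ∷ u₂ , cong (E ∷_) e , cong suc #E≡ , #N≡

dup-E-before : ∀ u y v → ∃[ u₂ ] dup E (u ++ E ∷ y ∷ v) ≡ u₂ ++ E ∷ y ∷ v
                               × #E u₂ ≡ suc (#E u) × #N u₂ ≡ #N u
dup-E-before []      y v = E ∷ [] , refl , refl , refl
dup-E-before (E ∷ u) y v = E ∷ E ∷ u , refl , refl , refl
dup-E-before (N ∷ u) y v =
  let (u₂ , e , #E≡ , #N≡) = dup-E-before u y v in N ∷ u₂ , cong (N ∷_) e , #E≡ , cong suc #N≡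

realise-S : ∀ n pr qt → RealisableGiven n (N ∷ E ∷ N ∷ pr) (E ∷ E ∷ qt)
realise-S n pr qt ih lp (le , ee , st) nm =
  Realisation-applyᴿ S refl (ih (N ∷ N ∷ pr) (E ∷ qt) (suc-injective lp) diag′ nm′)
    (mk⇔ (λ _ → N ∷ [] , pr , refl , refl) (λ _ → refl))
    (mk⇔ (λ ()) (⊥-elim ∘ ¬occursAt-one (λ _ ())))
    (λ ()) (λ _ → ¬occursAt-one (λ _ ())) (λ ())
  where
  diag′ : IsDiagramᴿ (N ∷ N ∷ pr) (E ∷ qt)
  diag′ = suc-injective le , suc-injective ee ,
          λ { (suc j) _ j< → ≤-pred (st (2 + j) (s≤s z≤n) (s≤s j<)) }
  nm′ : NonMixedᴿ (N ∷ N ∷ pr) (E ∷ qt)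
  nm′ _ _ []       _  _  ()
  nm′ _ _ (E ∷ _)  _  _  ()
  nm′ u v (N ∷ u′) v′ eq ep h₁ h₂ =
    nm (E ∷ u) v (N ∷ E ∷ u′) v′ (cong (E ∷_) eq) (cong (λ z → N ∷ E ∷ z) (∷-injectiveʳ ep))
       (s≤s h₁) h₂

realise-T : ∀ n pt qr → RealisableGiven n (N ∷ N ∷ pt) (E ∷ N ∷ E ∷ qr)
realise-T n pt qr ih lp (le , ee , st) nm =
  Realisation-applyᴿ T refl (ih (N ∷ pt) (E ∷ E ∷ qr) (suc-injective lp) diag′ nm′)
    (mk⇔ (λ ()) (⊥-elim ∘ ¬occursAt-one (λ _ ())))
    (mk⇔ (λ _ → E ∷ [] , qr , refl , refl) (λ _ → refl))
    (λ ()) (λ ()) (λ _ → ¬occursAt-one (λ _ ()))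
  where
  diag′ : IsDiagramᴿ (N ∷ pt) (E ∷ E ∷ qr)
  diag′ = suc-injective le , ee , λ { (suc j) _ j< → st (2 + j) (s≤s z≤n) (s≤s j<) }
  nm′ : NonMixedᴿ (N ∷ pt) (E ∷ E ∷ qr)
  nm′ []      _ _ _ ()
  nm′ (N ∷ _) _ _ _ ()
  nm′ (E ∷ u) v u′ v′ eq ep h₁ h₂ =
    nm (E ∷ N ∷ u) v (N ∷ u′) v′ (cong (λ z → E ∷ N ∷ z) (∷-injectiveʳ eq)) (cong (N ∷_) ep)
       h₁ (s≤s h₂)

realise-R : ∀ n pt l r → RealisableGiven n (N ∷ N ∷ pt) (replicate (suc l) E ++ N ∷ N ∷ r)
realise-R n pt l r ih lp (le , ee , st) nm =
  Realisation-applyᴿ R (cong (N ∷ N ∷ pt ,_) q≡) (ih (N ∷ pt) q′ (suc-injective lp) diag′ nm′)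
    (mk⇔ (λ ()) (⊥-elim ∘ ¬occursAt-one (λ _ ())))
    (mk⇔ (λ ()) (⊥-elim ∘ ¬occursAt-one (λ _ → replicate-E-NN≢NE l)))
    (λ ()) (λ ()) (λ ())
  where
  q′ : Path
  q′ = replicate (suc l) E ++ N ∷ r
  q≡ : dup N q′ ≡ replicate (suc l) E ++ N ∷ N ∷ r
  q≡ = dup-N-after-Es (suc l) r
  strict : ∀ j → 0 < j → j < length (N ∷ pt) → eastsIn j (N ∷ pt) < eastsIn j q′
  strict (suc j) _ j< with ≤-<-connex (suc j) (suc l)
  ... | inj₁ j≤l = subst (eastsIn j pt <_) (sym (eastsIn-replicate-E (suc j) (suc l) (N ∷ r) j≤l))
                         (s≤s (eastsIn≤ j pt))
  ... | inj₂ l<j = subst (eastsIn j pt <_) (sym (eastsIn-dup-N (suc j) (suc l) r l<j))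
                         (st (2 + j) (s≤s z≤n) (s≤s j<))
  diag′ : IsDiagramᴿ (N ∷ pt) q′
  diag′ = suc-injective (trans le (trans (cong length (sym q≡)) (length-dup N q′))) ,
          trans ee (trans (cong #E (sym q≡)) (#E-dup-N q′)) , strict
  nm′ : NonMixedᴿ (N ∷ pt) q′
  nm′ u v u′ v′ eq ep h₁ h₂ =
    let (u₂ , e , #E≡ , #N≡) = dup-N-before u E v
    in nm u₂ v (N ∷ u′) v′ (trans (sym q≡) (trans (cong (dup N) eq) e)) (cong (N ∷_) ep)
          (subst (suc (#E u′) <_) (sym #E≡) h₁)
          (subst (λ z → suc z < suc (#N u′)) (sym #N≡) (s≤s h₂))

realise-C : ∀ n k r qt → ¬ TopRowRepeated (replicate (suc k) N ++ E ∷ r , E ∷ qt) →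
  RealisableGiven n (replicate (suc k) N ++ E ∷ E ∷ r) (E ∷ E ∷ qt)
realise-C n k r qt ¬top ih lp (le , ee , st) nm =
  Realisation-applyᴿ C (cong (_, E ∷ E ∷ qt) p≡)
    (ih p′ (E ∷ qt) (suc-injective (trans (sym length-p) lp)) diag′ nm′)
    (mk⇔ (λ ()) (⊥-elim ∘ no-corner k))
    (mk⇔ (λ ()) (⊥-elim ∘ ¬occursAt-one (λ _ ())))
    (λ _ → ¬top) (λ ()) (λ ())
  where
  p′ : Path
  p′ = replicate (suc k) N ++ E ∷ r
  p≡ : dup E p′ ≡ replicate (suc k) N ++ E ∷ E ∷ r
  p≡ = dup-E-after-Ns (suc k) r
  length-p : length (replicate (suc k) N ++ E ∷ E ∷ r) ≡ suc (length p′)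
  length-p = trans (cong length (sym p≡)) (length-dup E p′)
  no-corner : ∀ k → ¬ OccursAt (E ∷ N ∷ []) 1 (replicate (suc k) N ++ E ∷ E ∷ r)
  no-corner zero    = ¬occursAt-one (λ _ ())
  no-corner (suc k) = ¬occursAt-one (λ _ ())
  strict : ∀ j → 0 < j → j < length p′ → eastsIn j p′ < eastsIn j (E ∷ qt)
  strict (suc j) _ j< with ≤-<-connex (suc j) (suc k)
  ... | inj₁ j≤k = subst (_< suc (eastsIn j qt))
                         (sym (eastsIn-replicate-N (suc j) (suc k) (E ∷ r) j≤k)) (s≤s z≤n)
  ... | inj₂ k<j = ≤-pred (subst (_< suc (suc (eastsIn j qt))) (eastsIn-dup-E (suc j) (suc k) r k<j)
                     (st (2 + j) (s≤s z≤n) (subst (2 + j <_) (sym length-p) (s≤s j<))))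
  diag′ : IsDiagramᴿ p′ (E ∷ qt)
  diag′ = suc-injective (trans (sym length-p) le) ,
          suc-injective (trans (sym (trans (cong #E (sym p≡)) (#E-dup-E p′))) ee) , strict
  nm′ : NonMixedᴿ p′ (E ∷ qt)
  nm′ u v u′ v′ eq ep h₁ h₂ =
    let (u₂ , e , #E≡ , #N≡) = dup-E-before u′ N v′
    in nm (E ∷ u) v u₂ v′ (cong (E ∷_) eq) (trans (sym p≡) (trans (cong (dup E) ep) e))
          (subst (λ z → suc z < suc (#E u)) (sym #E≡) (s≤s h₁))
          (subst (suc (#N u) <_) (sym #N≡) h₂)

opposite : Step → Step
opposite N = E
opposite E = N

data RunView (s : Step) : Path → Set where
  run-only : ∀ l → RunView s (replicate l s)
  run-then : ∀ l t → RunView s (replicate l s ++ opposite s ∷ t)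

RunView-∷ : ∀ {s x} → RunView s x → RunView s (s ∷ x)
RunView-∷ (run-only l)   = run-only (suc l)
RunView-∷ (run-then l t) = run-then (suc l) t

runView : ∀ s x → RunView s x
runView s []      = run-only 0
runView N (N ∷ x) = RunView-∷ (runView N x)
runView N (E ∷ t) = run-then 0 t
runView E (E ∷ x) = RunView-∷ (runView E x)
runView E (N ∷ t) = run-then 0 t

-- If neither the top row nor the rightmost column can be undone, the corners that end the
-- final runs of the two paths form a mixed pair.
realise-NN-EE : ∀ n pt qt → RunView N pt → RunView E qt →
  RealisableGiven n (N ∷ N ∷ pt) (E ∷ E ∷ qt)
realise-NN-EE n pt _ _ (run-only l) _ _ diag _
  with () ← trans (IsDiagramᴿ⇒#N≡ diag) (#N-replicate-E l)
realise-NN-EE n pt _ _ (run-then l []) _ _ diag _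
  with () ← trans (IsDiagramᴿ⇒#N≡ diag)
                  (trans (#N-++ (replicate l E) (N ∷ [])) (cong (_+ 1) (#N-replicate-E l)))
realise-NN-EE n pt _ _ (run-then l (N ∷ r)) ih lp diag nm = realise-R n pt (suc l) r ih lp diag nm
realise-NN-EE n _ _ (run-only k) (run-then _ (E ∷ _)) _ _ (_ , ee , _) _
  with () ← trans (sym (#E-replicate-N k)) ee
realise-NN-EE n _ _ (run-then k []) (run-then _ (E ∷ _)) _ _ (_ , ee , _) _
  with () ← trans (sym (trans (#E-++ (replicate k N) (E ∷ [])) (cong (_+ 1) (#E-replicate-N k)))) ee
realise-NN-EE n _ _ (run-then k (E ∷ r′)) (run-then l (E ∷ r)) =
  realise-C n (suc k) r′ _ λ (_ , (l′ , _ , q≡)) → replicate-E-NE≢NN l l′ (∷-injectiveʳ q≡)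
realise-NN-EE n _ _ (run-then k (N ∷ r′)) (run-then l (E ∷ r)) _ _ _ nm =
  ⊥-elim (nm (replicate (2 + l) E) r (replicate (2 + k) N) r′ refl refl
    (subst (λ z → suc z < 2 + #E (replicate l E)) (sym (#E-replicate-N k)) (s≤s (s≤s z≤n)))
    (subst (λ z → suc z < 2 + #N (replicate k N)) (sym (#N-replicate-E l)) (s≤s (s≤s z≤n))))

realise-step : ∀ n → Realisable n → Realisable (suc n)
realise-step n ih (_ ∷ _ ∷ _ ∷ _) (_ ∷ _ ∷ _ ∷ _) lp diag nm with IsDiagramᴿ-starts diag
realise-step n ih (N ∷ E ∷ _ ∷ _) (E ∷ N ∷ _ ∷ _) _ (_ , _ , st) _ | refl , refl =
  ⊥-elim (<-irrefl refl (st 2 (s≤s z≤n) (s≤s (s≤s (s≤s z≤n)))))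
realise-step n ih (N ∷ E ∷ N ∷ p) (E ∷ E ∷ q) lp diag nm | refl , refl =
  realise-S n p q ih lp diag nm
realise-step n ih (N ∷ E ∷ E ∷ p) (E ∷ E ∷ q) lp diag nm | refl , refl =
  realise-C n 0 p q (λ { ((_ , ()) , _) }) ih lp diag nm
realise-step n ih (N ∷ N ∷ p) (E ∷ N ∷ E ∷ q) lp diag nm | refl , refl =
  realise-T n p q ih lp diag nm
realise-step n ih (N ∷ N ∷ p) (E ∷ N ∷ N ∷ q) lp diag nm | refl , refl =
  realise-R n p 0 q ih lp diag nm
realise-step n ih (N ∷ N ∷ p) (E ∷ E ∷ q) lp diag nm | refl , refl =
  realise-NN-EE n p q (runView N p) (runView E q) ih lp diag nm

realise-base : Realisable 0
realise-base (_ ∷ _ ∷ []) (_ ∷ _ ∷ []) _ diag _ with IsDiagramᴿ-starts diag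
realise-base (N ∷ N ∷ []) (E ∷ _ ∷ []) _ (_ , () , _) _ | refl , refl
realise-base (N ∷ E ∷ []) (E ∷ E ∷ []) _ (_ , () , _) _ | refl , refl
realise-base (N ∷ E ∷ []) (E ∷ N ∷ []) _ _ _ | refl , refl =
  [] , refl ,
  ( (λ i → mk⇔ (⊥-elim ∘ occursAt-[]) (⊥-elim ∘ no-corner i))
  , (λ i → mk⇔ (⊥-elim ∘ occursAt-[]) (⊥-elim ∘ no-corner i))
  , no-factor ) ,
  no-factor , no-factor
  where
  no-corner : ∀ {x y z w : Step} i → ¬ OccursAt (x ∷ y ∷ []) (suc i) (z ∷ w ∷ [])
  no-corner zero    = ¬occursAt-one (λ _ ())
  no-corner (suc i) = occursAt-[] ∘ to occursAt-suc ∘ to occursAt-suc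
  no-factor : ∀ {x y : Letter} → ¬ Factor (x ∷ y ∷ []) []
  no-factor ([]    , _ , ())
  no-factor (_ ∷ _ , _ , ())

realise : ∀ n → Realisable n
realise zero    = realise-base
realise (suc n) = realise-step n (realise n)

split-at : ∀ {A : Set} i j (l : List A) → i + j ≡ length l →
  ∃[ a ] ∃[ b ] l ≡ a ++ b × length a ≡ i × length b ≡ j
split-at zero    j l       e = [] , l , refl , refl , sym e
split-at (suc i) j (x ∷ l) e =
  let (a , b , l≡ , length-a , length-b) = split-at i j l (suc-injective e)
  in x ∷ a , b , cong (x ∷_) l≡ , cong suc length-a , length-b

eastsIn-reverse : ∀ l i j → i + j ≡ length l → eastsIn j (reverse l) + eastsIn i l ≡ #E l
eastsIn-reverse l i j e with split-at i j l e
... | a , b , refl , refl , refl = begin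
  eastsIn (length b) (reverse (a ++ b)) + eastsIn (length a) (a ++ b)
    ≡⟨ cong₂ _+_ (cong (eastsIn (length b)) (reverse-++ a b)) (eastsIn-prefix a b) ⟩
  eastsIn (length b) (reverse b ++ reverse a) + #E a
    ≡⟨ cong (λ k → eastsIn k (reverse b ++ reverse a) + #E a) (length-reverse b) ⟨
  eastsIn (length (reverse b)) (reverse b ++ reverse a) + #E a
    ≡⟨ cong (_+ #E a) (trans (eastsIn-prefix (reverse b) (reverse a)) (#E-reverse b)) ⟩
  #E b + #E a
    ≡⟨ +-comm (#E b) (#E a) ⟩
  #E a + #E b
    ≡⟨ #E-++ a b ⟨
  #E (a ++ b) ∎
  where open ≡-Reasoning

IsDiagram⇒IsDiagramᴿ : ∀ {P Q} → IsDiagram P Q → IsDiagramᴿ (reverse P) (reverse Q)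
IsDiagram⇒IsDiagramᴿ {P} {Q} (le , _ , ee , st) =
  trans (length-reverse P) (trans le (sym (length-reverse Q))) ,
  trans (#E-reverse P) (trans #E≡ (sym (#E-reverse Q))) ,
  strict
  where
  #E≡ : #E P ≡ #E Q
  #E≡ = trans (sym (eastsIn-length P)) (trans ee (eastsIn-length Q))
  strict : ∀ j → 0 < j → j < length (reverse P) → eastsIn j (reverse P) < eastsIn j (reverse Q)
  strict j 0<j j< = +-cancelʳ-< (eastsIn i P) _ _ (begin-strict
    eastsIn j (reverse P) + eastsIn i P  ≡⟨ eastsIn-reverse P i j i+j≡ ⟩
    #E P                                 ≡⟨ #E≡ ⟩
    #E Q                                 ≡⟨ eastsIn-reverse Q i j (trans i+j≡ le) ⟨
    eastsIn j (reverse Q) + eastsIn i Q  <⟨ +-monoʳ-< _ (st i 0<i i<) ⟩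
    eastsIn j (reverse Q) + eastsIn i P  ∎)
    where
    open ≤-Reasoning
    j<P : j < length P
    j<P = subst (j <_) (length-reverse P) j<
    i : ℕ
    i = length P ∸ j
    i+j≡ : i + j ≡ length P
    i+j≡ = m∸n+n≡m (<⇒≤ j<P)
    0<i : 0 < i
    0<i = m<n⇒0<n∸m j<P
    i< : i < length P
    i< = subst (i <_) i+j≡ (m<m+n i 0<j)

yAt-N∷ : ∀ w k → yAt (N ∷ w) (suc k) ≡ suc (yAt w k)
yAt-N∷ w k = +-∸-assoc 1 (eastsIn≤ k w)

upper-corner-at : ∀ u v → xAt (u ++ E ∷ N ∷ v) (length u + 1) ≡ suc (#E u)
                        × yAt (u ++ E ∷ N ∷ v) (length u + 1) ≡ #N u
upper-corner-at []      v = refl , refl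
upper-corner-at (E ∷ u) v = let (x , y) = upper-corner-at u v in cong suc x , y
upper-corner-at (N ∷ u) v =
  let (x , y) = upper-corner-at u v in x , trans (yAt-N∷ _ (length u + 1)) (cong suc y)

lower-corner-at : ∀ u v → xAt (u ++ N ∷ E ∷ v) (length u + 1) ≡ #E u
                        × yAt (u ++ N ∷ E ∷ v) (length u + 1) ≡ suc (#N u)
lower-corner-at []      v = refl , refl
lower-corner-at (E ∷ u) v = let (x , y) = lower-corner-at u v in cong suc x , y
lower-corner-at (N ∷ u) v =
  let (x , y) = lower-corner-at u v in x , trans (yAt-N∷ _ (length u + 1)) (cong suc y)

<-from-totals : ∀ a x b y → a + suc x ≡ b + suc y → suc y < x → suc a < b
<-from-totals a x b y e y<x = +-cancelʳ-≤ (suc y) (suc (suc a)) b (begin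
  suc (suc a) + suc y    ≡⟨ trans (+-suc a _) (cong suc (+-suc a _)) ⟨
  a + suc (suc (suc y))  ≤⟨ +-monoʳ-≤ a (s≤s y<x) ⟩
  a + suc x              ≡⟨ e ⟩
  b + suc y              ∎)
  where open ≤-Reasoning

NonMixed⇒NonMixedᴿ : ∀ {P Q} → IsDiagramᴿ (reverse P) (reverse Q) → NonMixed P Q →
  NonMixedᴿ (reverse P) (reverse Q)
NonMixed⇒NonMixedᴿ {P} {Q} diagᴿ@(_ , #Eᴿ≡ , _) nm u v u′ v′ q≡ p≡ h₁ h₂ =
  nm (a , b , (reverse v , reverse u , Q≡ , refl) , (reverse v′ , reverse u′ , P≡ , refl) , x< , y<)
  where
  a b : ℕ
  a = length (reverse v) + 1
  b = length (reverse v′) + 1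
  Q≡ : Q ≡ reverse v ++ E ∷ N ∷ reverse u
  Q≡ = trans (sym (reverse-involutive Q)) (reverse-split u (N ∷ E ∷ []) v q≡)
  P≡ : P ≡ reverse v′ ++ N ∷ E ∷ reverse u′
  P≡ = trans (sym (reverse-involutive P)) (reverse-split u′ (E ∷ N ∷ []) v′ p≡)
  xQ : xAt Q a ≡ suc (#E v)
  xQ = trans (cong (λ l → xAt l a) Q≡)
             (trans (proj₁ (upper-corner-at (reverse v) (reverse u))) (cong suc (#E-reverse v)))
  yQ : yAt Q a ≡ #N v
  yQ = trans (cong (λ l → yAt l a) Q≡)
             (trans (proj₂ (upper-corner-at (reverse v) (reverse u))) (#N-reverse v))
  xP : xAt P b ≡ #E v′
  xP = trans (cong (λ l → xAt l b) P≡)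
             (trans (proj₁ (lower-corner-at (reverse v′) (reverse u′))) (#E-reverse v′))
  yP : yAt P b ≡ suc (#N v′)
  yP = trans (cong (λ l → yAt l b) P≡)
             (trans (proj₂ (lower-corner-at (reverse v′) (reverse u′))) (cong suc (#N-reverse v′)))
  swap : ∀ m n → m + suc n ≡ n + suc m
  swap m n = trans (+-suc m n) (trans (cong suc (+-comm m n)) (sym (+-suc n m)))
  #E-total : #E v + suc (#E u) ≡ #E v′ + suc (#E u′)
  #E-total = begin
    #E v + suc (#E u)      ≡⟨ swap (#E v) (#E u) ⟩
    #E u + suc (#E v)      ≡⟨ #E-++ u (N ∷ E ∷ v) ⟨
    #E (u ++ N ∷ E ∷ v)    ≡⟨ cong #E q≡ ⟨
    #E (reverse Q)         ≡⟨ #Eᴿ≡ ⟨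
    #E (reverse P)         ≡⟨ cong #E p≡ ⟩
    #E (u′ ++ E ∷ N ∷ v′)  ≡⟨ #E-++ u′ (E ∷ N ∷ v′) ⟩
    #E u′ + suc (#E v′)    ≡⟨ swap (#E u′) (#E v′) ⟩
    #E v′ + suc (#E u′)    ∎
    where open ≡-Reasoning
  #N-total : #N v′ + suc (#N u′) ≡ #N v + suc (#N u)
  #N-total = begin
    #N v′ + suc (#N u′)    ≡⟨ swap (#N v′) (#N u′) ⟩
    #N u′ + suc (#N v′)    ≡⟨ #N-++ u′ (E ∷ N ∷ v′) ⟨
    #N (u′ ++ E ∷ N ∷ v′)  ≡⟨ cong #N p≡ ⟨
    #N (reverse P)         ≡⟨ IsDiagramᴿ⇒#N≡ diagᴿ ⟩
    #N (reverse Q)         ≡⟨ cong #N q≡ ⟩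
    #N (u ++ N ∷ E ∷ v)    ≡⟨ #N-++ u (N ∷ E ∷ v) ⟩
    #N u + suc (#N v)      ≡⟨ swap (#N u) (#N v) ⟩
    #N v + suc (#N u)      ∎
    where open ≡-Reasoning
  x< : xAt Q a < xAt P b
  x< = subst₂ _<_ (sym xQ) (sym xP) (<-from-totals (#E v) (#E u) (#E v′) (#E u′) #E-total h₁)
  y< : yAt P b < yAt Q a
  y< = subst₂ _<_ (sym yP) (sym yQ) (<-from-totals (#N v′) (#N u′) (#N v) (#N u) #N-total h₂)

existence : ∀ {P Q} → IsDiagram P Q → NonMixed P Q → Realisation (reverse P , reverse Q)
existence {P} {Q} diag nm =
  let (n , 2+n≡) = m≤n⇒∃[o]m+o≡n (proj₁ (proj₂ diag))
  in realise n (reverse P) (reverse Q) (trans (length-reverse P) (sym 2+n≡))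
             diagᴿ (NonMixed⇒NonMixedᴿ diagᴿ nm)
  where
  diagᴿ : IsDiagramᴿ (reverse P) (reverse Q)
  diagᴿ = IsDiagram⇒IsDiagramᴿ diag

corollary5p3 : (P Q : Path) → IsDiagram P Q → NonMixed P Q →
    Σ Word λ w →
      (D w ≡ (P , Q) × Good w ×
       ¬ Factor (S ∷ S ∷ []) w × ¬ Factor (T ∷ T ∷ []) w) ×
      (∀ w′ → D w′ ≡ (P , Q) → Good w′ → w′ ≡ w)
corollary5p3 P Q diag nm with existence diag nm
... | r , Dᴿr≡ , good , no-SS , no-TT =
  reverse r ,
  (D-w , from (Good-reverse r) good ,
   no-SS ∘ from (Factor⇔reverse (S ∷ S ∷ []) r) , no-TT ∘ from (Factor⇔reverse (T ∷ T ∷ []) r)) ,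
  unique
  where
  D-w : D (reverse r) ≡ (P , Q)
  D-w = trans (D-reverse r) (trans (cong mirror Dᴿr≡) (mirror-involutive (P , Q)))
  unique : ∀ w′ → D w′ ≡ (P , Q) → Good w′ → w′ ≡ reverse r
  unique w′ Dw′≡ good′ =
    trans (sym (reverse-involutive w′))
          (cong reverse (Goodᴿ-unique (reverse w′) r (to (Good⇔Goodᴿ w′) good′) good Dᴿ≡))
    where
    Dᴿ≡ : Dᴿ (reverse w′) ≡ Dᴿ r
    Dᴿ≡ = begin
      Dᴿ (reverse w′)                    ≡⟨ mirror-involutive _ ⟨
      mirror (mirror (Dᴿ (reverse w′)))  ≡⟨ cong mirror (trans (sym (D≡mirror-Dᴿ w′)) Dw′≡) ⟩
      mirror (P , Q)                     ≡⟨ Dᴿr≡ ⟨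
      Dᴿ r                               ∎
      where open ≡-Reasoning
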